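{- Let $r$ be an odd positive integer and let $G$ be an $r$-regular, nonbipartite, connected graph. Then $G$ contains a good even tree, i.e., a subgraph $T$ of $G$ that is an even tree such that the graph $G \setminus V(T)$ (obtained by deleting the vertices of $T$) has a good $\{1,2\}$-factor.
   Context: All graphs are finite and contain no loops. A tree is called even if every pair of its vertices of degree one (leaves) is joined in the tree by a path of even length. A spanning subgraph $F$ of a graph $H$ (i.e., $V(F)=V(H)$) is a $\{1,2\}$-factor of $H$ if $1 \le d_F(x) \le 2$ for all $x \in V(H)$; it is good if each of its components is regular (so each component is a single edge or a cycle). An even tree $T$ in $G$ is good if $G \setminus V(T)$ has a good $\{1,2\}$-factor (this holds vacuously if $V(T)=V(G)$). -}

module Defs where

open import Data.Nat using (ℕ; zero; suc; _+_; _*_; _≤_; _<_)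
open import Data.Nat.Divisibility using (_∣_)
open import Data.Fin using (Fin)
open import Data.Bool using (Bool; true; false)
open import Data.List using (List; []; _∷_; tabulate)
open import Data.Nat.ListAction using (sum)
open import Data.List.Relation.Unary.Unique.Propositional using (Unique)
open import Data.Product using (Σ; ∃; ∃-syntax; _×_)
open import Relation.Binary.PropositionalEquality using (_≡_; _≢_)
open import Relation.Nullary using (¬_)

-- A finite loopless multigraph on vertex set Fin n, given by edge multiplicities.
-- (Simple graphs are the special case where all multiplicities are ≤ 1.)
record Graph (n : ℕ) : Set where
  field
    mult     : Fin n → Fin n → ℕ
    symm     : ∀ x y → mult x y ≡ mult y x
    loopless : ∀ x → mult x x ≡ 0
open Graph public

EdgeFn : ℕ → Set
EdgeFn n = Fin n → Fin n → ℕ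

deg : ∀ {n} → EdgeFn n → Fin n → ℕ
deg E x = sum (tabulate (E x))

data Walk {n} (E : EdgeFn n) : Fin n → Fin n → ℕ → Set where
  []  : ∀ {x} → Walk E x x 0
  _∷_ : ∀ {x y z k} → 0 < E x y → Walk E y z k → Walk E x z (suc k)

verts : ∀ {n} {E : EdgeFn n} {x y k} → Walk E x y k → List (Fin n)
verts {x = x} []      = x ∷ []
verts {x = x} (_ ∷ w) = x ∷ verts w

IsPath : ∀ {n} {E : EdgeFn n} {x y k} → Walk E x y k → Set
IsPath w = Unique (verts w)

Connected : ∀ {n} → EdgeFn n → Set
Connected E = ∀ x y → ∃[ k ] Walk E x y k

RegularGraph : ∀ {n} → Graph n → ℕ → Set
RegularGraph G r = ∀ x → deg (mult G) x ≡ r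

Bipartite : ∀ {n} → Graph n → Set
Bipartite {n} G = Σ (Fin n → Bool) λ c → ∀ x y → 0 < mult G x y → c x ≢ c y

OddPos : ℕ → Set
OddPos r = ∃[ k ] r ≡ suc (2 * k)

SubgraphOn : ∀ {n} → Graph n → (Fin n → Bool) → EdgeFn n → Set
SubgraphOn G S E =
  (∀ x y → E x y ≤ mult G x y) ×
  (∀ x y → E x y ≡ E y x) ×
  (∀ x y → 0 < E x y → (S x ≡ true) × (S y ≡ true))

-- (S , t) is a tree: nonempty, no parallel edges, connected on S, and with no
-- cycle (a cycle of length ≥ 3: a path x … y with at least one edge, plus an edge y x;
-- cycles of length 2 are excluded by t ≤ 1).
IsTree : ∀ {n} → (Fin n → Bool) → EdgeFn n → Set
IsTree {n} S t =
  (∃[ x ] S x ≡ true) ×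
  (∀ x y → t x y ≤ 1) ×
  (∀ x y → S x ≡ true → S y ≡ true → ∃[ k ] Walk t x y k) ×
  (¬ (Σ (Fin n) λ x → Σ (Fin n) λ y → Σ ℕ λ k → Σ (Walk t x y (suc (suc k))) λ w →
        IsPath w × (0 < t y x)))

IsEvenTree : ∀ {n} → (Fin n → Bool) → EdgeFn n → Set
IsEvenTree {n} S t =
  IsTree S t ×
  (∀ x y → S x ≡ true → S y ≡ true → deg t x ≡ 1 → deg t y ≡ 1 →
     Σ ℕ λ k → Σ (Walk t x y k) λ w → IsPath w × (2 ∣ k))

-- F is a good {1,2}-factor of G ∖ S (the graph obtained from G by deleting the
-- vertices with S x ≡ true): spanning subgraph of G ∖ S, all degrees in {1,2},
-- every component regular.
GoodFactorOfComplement : ∀ {n} → Graph n → (Fin n → Bool) → EdgeFn n → Set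
GoodFactorOfComplement {n} G S f =
  (∀ x y → f x y ≤ mult G x y) ×
  (∀ x y → f x y ≡ f y x) ×
  (∀ x y → 0 < f x y → (S x ≡ false) × (S y ≡ false)) ×
  (∀ x → S x ≡ false → (1 ≤ deg f x) × (deg f x ≤ 2)) ×
  (∀ x y k → Walk f x y k → deg f x ≡ deg f y)

HasGoodEvenTree : ∀ {n} → Graph n → Set
HasGoodEvenTree {n} G =
  Σ (Fin n → Bool) λ S → Σ (EdgeFn n) λ t →
    SubgraphOn G S t × IsEvenTree S t ×
    Σ (EdgeFn n) λ f → GoodFactorOfComplement G S f

{-# OPTIONS --safe #-}
module Submission where

-- Take the one-vertex tree {v}; what remains is a good {1,2}-factor of G − v. It comes from
-- a permutation σ of V(G) whose only fixed point is v and which sends every other vertex to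
-- a neighbour: the 2-cycles of σ give single edges, the longer cycles give cycles. Such a σ
-- is a matching of V − v into itself along edges, so by Hall's theorem it exists once
-- |N(A) − v| ≥ |A| for every nonempty A ⊆ V − v. Counting the edges at A from both ends in
-- the r-regular graph gives |N(A)| ≥ |A|, and equality forces every edge at N(A) to end in
-- A; in a connected graph that makes membership in A a proper 2-colouring unless v ∈ A.
-- Hence |N(A)| > |A|, which suffices.

open import Defs
open import Data.Bool using (Bool; true; false; if_then_else_)
open import Data.Fin using (Fin; zero; suc; punchOut)
open import Data.Fin.Properties using (any?; punchOut-injective; injective⇒≤) renaming (_≟_ to _≟ᶠ_)
open import Data.Fin.Subset
open import Data.Fin.Subset.Properties
open import Data.List using (tabulate)
open import Data.Nat using (ℕ; zero; suc; _+_; _*_; _≤_; _<_; z≤n; s≤s; s≤s⁻¹; _≤?_; _<?_)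
open import Data.Nat.Induction using (<-wellFounded)
open import Data.Nat.ListAction using (sum)
open import Data.Nat.Properties
open import Algebra.Properties.Semiring.Sum +-*-semiring
  using (sum-syntax; sum-cong-≗; sum-replicate-zero; ∑-comm; *-distribˡ-sum) renaming (sum to ∑)
open import Data.Product using (_×_; _,_; proj₁; proj₂; ∃)
open import Data.Sum using (_⊎_; inj₁; inj₂; swap)
open import Data.Vec using (_∷_; []; here; there) renaming (tabulate to tabulateᵛ)
open import Data.Vec.Properties using (lookup∘tabulate; []=⇒lookup; lookup⇒[]=)
open import Function using (_∘_)
open import Function.Definitions using (Injective)
open import Induction.WellFounded using (Acc; acc)
open import Relation.Binary.PropositionalEquality
open import Relation.Nullary using (Dec; yes; no; does; ¬_; contradiction; _×-dec_)
open import Relation.Nullary.Decidable using (dec-true; dec-false; decidable-stable; does-≡; map′; ¬?; _⊎-dec_)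
open import Relation.Unary using (Decidable)

𝟙 : ∀ {P : Set} → Dec P → ℕ
𝟙 P? = if does P? then 1 else 0

injective⇒surjective : ∀ {n} {f : Fin n → Fin n} → Injective _≡_ _≡_ f → ∀ y → ∃ λ x → f x ≡ y
injective⇒surjective {suc n} {f} f-injective y with any? (λ x → f x ≟ᶠ y)
... | yes hit  = hit
... | no  miss = contradiction (injective⇒≤ punchOut∘f-injective) 1+n≰n
  where
  y≢f : ∀ x → y ≢ f x
  y≢f x y≡fx = miss (x , sym y≡fx)
  punchOut∘f-injective : Injective _≡_ _≡_ (λ x → punchOut (y≢f x))
  punchOut∘f-injective = f-injective ∘ punchOut-injective (y≢f _) (y≢f _)

𝟙-cong : ∀ {P Q : Set} → (P → Q) → (Q → P) → (P? : Dec P) (Q? : Dec Q) → 𝟙 P? ≡ 𝟙 Q?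
𝟙-cong P→Q Q→P P? Q? = cong (if_then 1 else 0) (does-≡ (map′ P→Q Q→P P?) Q?)

0<𝟙⇒P : ∀ {P : Set} (P? : Dec P) → 0 < 𝟙 P? → P
0<𝟙⇒P (yes p) _ = p

𝟙-≤ : ∀ {P : Set} {m} (P? : Dec P) → (P → 0 < m) → 𝟙 P? ≤ m
𝟙-≤ (yes p) P⇒0<m = P⇒0<m p
𝟙-≤ (no _)  _     = z≤n

sum-tabulate : ∀ {n} (f : Fin n → ℕ) → sum (tabulate f) ≡ ∑[ i < n ] f i
sum-tabulate {zero}  f = refl
sum-tabulate {suc n} f = cong (f zero +_) (sum-tabulate (f ∘ suc))

∑-mono-≤ : ∀ {n} {f g : Fin n → ℕ} → (∀ i → f i ≤ g i) → ∑[ i < n ] f i ≤ ∑[ i < n ] g i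
∑-mono-≤ {zero}  f≤g = z≤n
∑-mono-≤ {suc n} f≤g = +-mono-≤ (f≤g zero) (∑-mono-≤ (f≤g ∘ suc))

∑-mono-< : ∀ {n} {f g : Fin n → ℕ} → (∀ i → f i ≤ g i) → ∀ j → f j < g j →
           ∑[ i < n ] f i < ∑[ i < n ] g i
∑-mono-< f≤g zero    fj<gj = +-mono-<-≤ fj<gj (∑-mono-≤ (f≤g ∘ suc))
∑-mono-< f≤g (suc j) fj<gj = +-mono-≤-< (f≤g zero) (∑-mono-< (f≤g ∘ suc) j fj<gj)

∑-mono-≤-≗ : ∀ {n} {f g : Fin n → ℕ} → (∀ i → f i ≤ g i) →
             ∑[ i < n ] g i ≤ ∑[ i < n ] f i → ∀ i → f i ≡ g i
∑-mono-≤-≗ {f = f} {g} f≤g ∑g≤∑f i with f i ≟ g i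
... | yes fi≡gi = fi≡gi
... | no  fi≢gi = contradiction ∑g≤∑f (<⇒≱ (∑-mono-< f≤g i (≤∧≢⇒< (f≤g i) fi≢gi)))

subset : ∀ {n} {P : Fin n → Set} → Decidable P → Subset n
subset P? = tabulateᵛ (does ∘ P?)

module _ {n} {P : Fin n → Set} (P? : Decidable P) {x : Fin n} where

  ∈-subset⁺ : P x → x ∈ subset P?
  ∈-subset⁺ px = lookup⇒[]= x _ (trans (lookup∘tabulate _ x) (dec-true (P? x) px))

  ∈-subset⁻ : x ∈ subset P? → P x
  ∈-subset⁻ x∈ with P? x | trans (sym (lookup∘tabulate (does ∘ P?) x)) ([]=⇒lookup x∈)
  ... | yes px | _ = px

∣p∣≡∑𝟙 : ∀ {n} (p : Subset n) → ∣ p ∣ ≡ ∑[ x < n ] 𝟙 (x ∈? p)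
∣p∣≡∑𝟙 []            = refl
∣p∣≡∑𝟙 (true  ∷ p) = cong suc (∣p∣≡∑𝟙 p)
∣p∣≡∑𝟙 (false ∷ p) = ∣p∣≡∑𝟙 p

Empty⇒∣p∣≡0 : ∀ {n} {p : Subset n} → Empty p → ∣ p ∣ ≡ 0
Empty⇒∣p∣≡0 {n} empty = trans (cong ∣_∣ (Empty-unique empty)) (∣⊥∣≡0 n)

∣p∪q∣+∣p∩q∣≡∣p∣+∣q∣ : ∀ {n} (p q : Subset n) → ∣ p ∪ q ∣ + ∣ p ∩ q ∣ ≡ ∣ p ∣ + ∣ q ∣
∣p∪q∣+∣p∩q∣≡∣p∣+∣q∣ []          []          = refl
∣p∪q∣+∣p∩q∣≡∣p∣+∣q∣ (true  ∷ p) (true  ∷ q) = cong suc (begin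
  ∣ p ∪ q ∣ + suc ∣ p ∩ q ∣    ≡⟨ +-suc _ _ ⟩
  suc (∣ p ∪ q ∣ + ∣ p ∩ q ∣)  ≡⟨ cong suc (∣p∪q∣+∣p∩q∣≡∣p∣+∣q∣ p q) ⟩
  suc (∣ p ∣ + ∣ q ∣)          ≡⟨ +-suc _ _ ⟨
  ∣ p ∣ + suc ∣ q ∣            ∎)
  where open ≡-Reasoning
∣p∪q∣+∣p∩q∣≡∣p∣+∣q∣ (true  ∷ p) (false ∷ q) = cong suc (∣p∪q∣+∣p∩q∣≡∣p∣+∣q∣ p q)
∣p∪q∣+∣p∩q∣≡∣p∣+∣q∣ (false ∷ p) (true  ∷ q) = trans (cong suc (∣p∪q∣+∣p∩q∣≡∣p∣+∣q∣ p q)) (sym (+-suc _ _))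
∣p∪q∣+∣p∩q∣≡∣p∣+∣q∣ (false ∷ p) (false ∷ q) = ∣p∪q∣+∣p∩q∣≡∣p∣+∣q∣ p q

∣p∪q∣≤∣p∣+∣q∣ : ∀ {n} (p q : Subset n) → ∣ p ∪ q ∣ ≤ ∣ p ∣ + ∣ q ∣
∣p∪q∣≤∣p∣+∣q∣ p q = ≤-trans (m≤m+n _ _) (≤-reflexive (∣p∪q∣+∣p∩q∣≡∣p∣+∣q∣ p q))

Empty[p∩q]⇒∣p∪q∣≡∣p∣+∣q∣ : ∀ {n} (p q : Subset n) → Empty (p ∩ q) → ∣ p ∪ q ∣ ≡ ∣ p ∣ + ∣ q ∣
Empty[p∩q]⇒∣p∪q∣≡∣p∣+∣q∣ p q empty = begin
  ∣ p ∪ q ∣                ≡⟨ +-identityʳ _ ⟨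
  ∣ p ∪ q ∣ + 0            ≡⟨ cong (∣ p ∪ q ∣ +_) (Empty⇒∣p∣≡0 empty) ⟨
  ∣ p ∪ q ∣ + ∣ p ∩ q ∣    ≡⟨ ∣p∪q∣+∣p∩q∣≡∣p∣+∣q∣ p q ⟩
  ∣ p ∣ + ∣ q ∣            ∎
  where open ≡-Reasoning

x∈p─q⇒x∉q : ∀ {n} {p q : Subset n} {x} → x ∈ p ─ q → x ∉ q
x∈p─q⇒x∉q {p = _ ∷ _} {true ∷ _} ()         here
x∈p─q⇒x∉q {p = _ ∷ _} {_    ∷ _} (there x∈) (there x∈q) = x∈p─q⇒x∉q x∈ x∈q

∣p∣≤1+∣p-x∣ : ∀ {n} (p : Subset n) x → ∣ p ∣ ≤ suc ∣ p - x ∣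
∣p∣≤1+∣p-x∣ p x = begin
  ∣ p ∣                   ≤⟨ p⊆q⇒∣p∣≤∣q∣ p⊆⁅x⁆∪[p-x] ⟩
  ∣ ⁅ x ⁆ ∪ (p - x) ∣     ≤⟨ ∣p∪q∣≤∣p∣+∣q∣ ⁅ x ⁆ (p - x) ⟩
  ∣ ⁅ x ⁆ ∣ + ∣ p - x ∣   ≡⟨ cong (_+ ∣ p - x ∣) (∣⁅x⁆∣≡1 x) ⟩
  suc ∣ p - x ∣           ∎
  where
  open ≤-Reasoning
  p⊆⁅x⁆∪[p-x] : p ⊆ ⁅ x ⁆ ∪ (p - x)
  p⊆⁅x⁆∪[p-x] {y} y∈p with y ≟ᶠ x
  ... | yes refl = x∈p∪q⁺ (inj₁ (x∈⁅x⁆ x))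
  ... | no  y≢x  = x∈p∪q⁺ (inj₂ (x∈p∧x≢y⇒x∈p-y y∈p y≢x))

0<∣p∣⇒Nonempty : ∀ {n} (p : Subset n) → 0 < ∣ p ∣ → Nonempty p
0<∣p∣⇒Nonempty p 0<∣p∣ with nonempty? p
... | yes nonempty = nonempty
... | no  empty    = contradiction (Empty⇒∣p∣≡0 empty) (>⇒≢ 0<∣p∣)

x≡y⇒∣⁅x⁆∪⁅y⁆∣≡1 : ∀ {n} {x y : Fin n} → x ≡ y → ∣ ⁅ x ⁆ ∪ ⁅ y ⁆ ∣ ≡ 1
x≡y⇒∣⁅x⁆∪⁅y⁆∣≡1 {x = x} refl = trans (cong ∣_∣ (∪-idem ⁅ x ⁆)) (∣⁅x⁆∣≡1 x)

x≢y⇒∣⁅x⁆∪⁅y⁆∣≡2 : ∀ {n} {x y : Fin n} → x ≢ y → ∣ ⁅ x ⁆ ∪ ⁅ y ⁆ ∣ ≡ 2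
x≢y⇒∣⁅x⁆∪⁅y⁆∣≡2 {x = x} {y} x≢y = begin
  ∣ ⁅ x ⁆ ∪ ⁅ y ⁆ ∣       ≡⟨ Empty[p∩q]⇒∣p∪q∣≡∣p∣+∣q∣ ⁅ x ⁆ ⁅ y ⁆ disjoint ⟩
  ∣ ⁅ x ⁆ ∣ + ∣ ⁅ y ⁆ ∣   ≡⟨ cong₂ _+_ (∣⁅x⁆∣≡1 x) (∣⁅x⁆∣≡1 y) ⟩
  2                       ∎
  where
  open ≡-Reasoning
  disjoint : Empty (⁅ x ⁆ ∩ ⁅ y ⁆)
  disjoint (z , z∈) with x∈p∩q⁻ ⁅ x ⁆ ⁅ y ⁆ z∈
  ... | z∈⁅x⁆ , z∈⁅y⁆ = x≢y (trans (sym (x∈⁅y⁆⇒x≡y x z∈⁅x⁆)) (x∈⁅y⁆⇒x≡y y z∈⁅y⁆))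

module Hall {n : ℕ} where

  reachable? : (R : Fin n → Subset n) (A : Subset n) → Decidable (λ y → ∃ λ x → x ∈ A × y ∈ R x)
  reachable? R A y = any? (λ x → x ∈? A ×-dec y ∈? R x)

  neighbours : (Fin n → Subset n) → Subset n → Subset n
  neighbours R A = subset (reachable? R A)

  module _ {R : Fin n → Subset n} {A : Subset n} {y : Fin n} where

    ∈-neighbours⁺ : ∀ {x} → x ∈ A → y ∈ R x → y ∈ neighbours R A
    ∈-neighbours⁺ {x} x∈A y∈Rx = ∈-subset⁺ (reachable? R A) (x , x∈A , y∈Rx)

    ∈-neighbours⁻ : y ∈ neighbours R A → ∃ λ x → x ∈ A × y ∈ R x
    ∈-neighbours⁻ = ∈-subset⁻ (reachable? R A)

  HallCondition : (Fin n → Subset n) → Subset n → Set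
  HallCondition R X = ∀ {A} → A ⊆ X → ∣ A ∣ ≤ ∣ neighbours R A ∣

  record Matching (R : Fin n → Subset n) (X : Subset n) : Set where
    field
      match           : Fin n → Fin n
      match-∈         : ∀ {x} → x ∈ X → match x ∈ R x
      match-injective : ∀ {x x′} → x ∈ X → x′ ∈ X → match x ≡ match x′ → x ≡ x′
  open Matching public

  Empty⇒Matching : ∀ {R X} → Empty X → Matching R X
  Empty⇒Matching empty = record
    { match           = λ x → x
    ; match-∈         = λ x∈X → contradiction (_ , x∈X) empty
    ; match-injective = λ x∈X _ _ → contradiction (_ , x∈X) empty
    }

  glue : ∀ {R X} A C (M₁ : Matching R A) → (∀ {x} → x ∈ A → match M₁ x ∈ C) →
         Matching (λ x → R x ─ C) (X ─ A) → Matching R X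
  glue {R} {X} A C M₁ M₁∈C M₂ = record
    { match = f ; match-∈ = f-∈ ; match-injective = f-injective }
    where
    f : Fin n → Fin n
    f x = if does (x ∈? A) then match M₁ x else match M₂ x

    X─A : ∀ {x} → x ∈ X → x ∉ A → x ∈ X ─ A
    X─A = x∈p∧x∉q⇒x∈p─q

    f-∈ : ∀ {x} → x ∈ X → f x ∈ R x
    f-∈ {x} x∈X with x ∈? A
    ... | yes x∈A = match-∈ M₁ x∈A
    ... | no  x∉A = p─q⊆p _ C (match-∈ M₂ (X─A x∈X x∉A))

    f-injective : ∀ {x x′} → x ∈ X → x′ ∈ X → f x ≡ f x′ → x ≡ x′
    f-injective {x} {x′} x∈X x′∈X fx≡fx′ with x ∈? A | x′ ∈? A
    ... | yes x∈A | yes x′∈A = match-injective M₁ x∈A x′∈A fx≡fx′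
    ... | no  x∉A | no  x′∉A = match-injective M₂ (X─A x∈X x∉A) (X─A x′∈X x′∉A) fx≡fx′
    ... | yes x∈A | no  x′∉A =
      contradiction (subst (_∈ C) fx≡fx′ (M₁∈C x∈A)) (x∈p─q⇒x∉q (match-∈ M₂ (X─A x′∈X x′∉A)))
    ... | no  x∉A | yes x′∈A =
      contradiction (subst (_∈ C) (sym fx≡fx′) (M₁∈C x′∈A)) (x∈p─q⇒x∉q (match-∈ M₂ (X─A x∈X x∉A)))

  HallCondition-⊆ : ∀ {R X Y} → HallCondition R X → Y ⊆ X → HallCondition R Y
  HallCondition-⊆ hallX Y⊆X A⊆Y = hallX (Y⊆X ∘ A⊆Y)

  HallCondition-─-neighbours : ∀ {R X A} → HallCondition R X → A ⊆ X →
    ∣ neighbours R A ∣ ≤ ∣ A ∣ → HallCondition (λ x → R x ─ neighbours R A) (X ─ A)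
  HallCondition-─-neighbours {R} {X} {A} hallX A⊆X tight {B} B⊆X─A = +-cancelˡ-≤ ∣ A ∣ _ _ (begin
    ∣ A ∣ + ∣ B ∣                 ≡⟨ Empty[p∩q]⇒∣p∪q∣≡∣p∣+∣q∣ A B disjoint ⟨
    ∣ A ∪ B ∣                     ≤⟨ hallX A∪B⊆X ⟩
    ∣ neighbours R (A ∪ B) ∣      ≤⟨ p⊆q⇒∣p∣≤∣q∣ split ⟩
    ∣ NA ∪ neighbours R′ B ∣      ≤⟨ ∣p∪q∣≤∣p∣+∣q∣ NA _ ⟩
    ∣ NA ∣ + ∣ neighbours R′ B ∣  ≤⟨ +-monoˡ-≤ _ tight ⟩
    ∣ A ∣ + ∣ neighbours R′ B ∣   ∎)
    where
    open ≤-Reasoning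
    NA = neighbours R A
    R′ = λ x → R x ─ NA

    B∉A : ∀ {x} → x ∈ B → x ∉ A
    B∉A = x∈p─q⇒x∉q ∘ B⊆X─A

    disjoint : Empty (A ∩ B)
    disjoint (x , x∈A∩B) with x∈p∩q⁻ A B x∈A∩B
    ... | x∈A , x∈B = B∉A x∈B x∈A

    A∪B⊆X : A ∪ B ⊆ X
    A∪B⊆X x∈A∪B with x∈p∪q⁻ A B x∈A∪B
    ... | inj₁ x∈A = A⊆X x∈A
    ... | inj₂ x∈B = p─q⊆p X A (B⊆X─A x∈B)

    split : neighbours R (A ∪ B) ⊆ NA ∪ neighbours R′ B
    split {y} y∈N with ∈-neighbours⁻ y∈N | y ∈? NA
    ... | _ | yes y∈NA = x∈p∪q⁺ (inj₁ y∈NA)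
    ... | x , x∈A∪B , y∈Rx | no y∉NA with x∈p∪q⁻ A B x∈A∪B
    ...   | inj₁ x∈A = contradiction (∈-neighbours⁺ x∈A y∈Rx) y∉NA
    ...   | inj₂ x∈B = x∈p∪q⁺ (inj₂ (∈-neighbours⁺ x∈B (x∈p∧x∉q⇒x∈p─q y∈Rx y∉NA)))

  surplus⇒HallCondition-y : ∀ {R X} y → (∀ {A} → A ⊆ X → Nonempty A → ∣ A ∣ < ∣ neighbours R A ∣) →
                            HallCondition (λ x → R x - y) X
  surplus⇒HallCondition-y {R} y surplus {A} A⊆X with nonempty? A
  ... | no  empty    = ≤-trans (≤-reflexive (Empty⇒∣p∣≡0 empty)) z≤n
  ... | yes nonempty = s≤s⁻¹ (begin-strict
    ∣ A ∣                                  <⟨ surplus A⊆X nonempty ⟩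
    ∣ neighbours R A ∣                     ≤⟨ ∣p∣≤1+∣p-x∣ (neighbours R A) y ⟩
    suc ∣ neighbours R A - y ∣             ≤⟨ s≤s (p⊆q⇒∣p∣≤∣q∣ drop-y) ⟩
    suc ∣ neighbours (λ x → R x - y) A ∣   ∎)
    where
    open ≤-Reasoning
    drop-y : neighbours R A - y ⊆ neighbours (λ x → R x - y) A
    drop-y z∈ with ∈-neighbours⁻ (p─q⊆p (neighbours R A) ⁅ y ⁆ z∈)
    ... | x , x∈A , z∈Rx = ∈-neighbours⁺ x∈A (x∈p∧x∉q⇒x∈p─q z∈Rx (x∈p─q⇒x∉q z∈))

  HallCondition⇒∃∈R : ∀ {R X x} → HallCondition R X → x ∈ X → ∃ λ y → y ∈ R x
  HallCondition⇒∃∈R {R} {X} {x} hallX x∈X with 0<∣p∣⇒Nonempty (neighbours R ⁅ x ⁆) 0<∣N⁅x⁆∣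
    where
    0<∣N⁅x⁆∣ = ≤-trans (≤-reflexive (sym (∣⁅x⁆∣≡1 x)))
                       (hallX (λ z∈⁅x⁆ → subst (_∈ X) (sym (x∈⁅y⁆⇒x≡y x z∈⁅x⁆)) x∈X))
  ... | y , y∈N with ∈-neighbours⁻ y∈N
  ...   | z , z∈⁅x⁆ , y∈Rz = y , subst (λ z → y ∈ R z) (x∈⁅y⁆⇒x≡y x z∈⁅x⁆) y∈Rz

  ⁅⁆-Matching : ∀ {R x y} → y ∈ R x → Matching R ⁅ x ⁆
  ⁅⁆-Matching {R} {x} {y} y∈Rx = record
    { match           = λ _ → y
    ; match-∈         = λ z∈⁅x⁆ → subst (λ z → y ∈ R z) (sym (x∈⁅y⁆⇒x≡y x z∈⁅x⁆)) y∈Rx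
    ; match-injective = λ z∈⁅x⁆ z′∈⁅x⁆ _ → trans (x∈⁅y⁆⇒x≡y x z∈⁅x⁆) (sym (x∈⁅y⁆⇒x≡y x z′∈⁅x⁆))
    }

  Tight : (Fin n → Subset n) → Subset n → Subset n → Set
  Tight R X A = A ⊆ X × Nonempty A × ∣ A ∣ < ∣ X ∣ × ∣ neighbours R A ∣ ≤ ∣ A ∣

  tight? : ∀ R X → Decidable (Tight R X)
  tight? R X A = A ⊆? X ×-dec nonempty? A ×-dec ∣ A ∣ <? ∣ X ∣ ×-dec ∣ neighbours R A ∣ ≤? ∣ A ∣

  -- A tight set A splits X into A and X ─ A, the latter to be matched
  -- outside N A; without one every nonempty B ⊂ X has surplus, so some x₀ ∈ X can take any
  -- neighbour y₀ and both are removed.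
  hall : ∀ {R} X → HallCondition R X → Matching R X
  hall X = go X (<-wellFounded ∣ X ∣)
    where
    go : ∀ {R} X → Acc _<_ ∣ X ∣ → HallCondition R X → Matching R X
    go {R} X (acc rec) hallX with nonempty? X | anySubset? (tight? R X)
    ... | no empty | _ = Empty⇒Matching empty
    ... | yes _ | yes (A , A⊆X , (a , a∈A) , ∣A∣<∣X∣ , tight) =
      glue A (neighbours R A) M₁ (λ x∈A → ∈-neighbours⁺ x∈A (match-∈ M₁ x∈A)) M₂
      where
      M₁ : Matching R A
      M₁ = go A (rec ∣A∣<∣X∣) (HallCondition-⊆ hallX A⊆X)
      ∣X─A∣<∣X∣ : ∣ X ─ A ∣ < ∣ X ∣
      ∣X─A∣<∣X∣ = p∩q≢∅⇒∣p─q∣<∣p∣ X A (a , x∈p∩q⁺ (A⊆X a∈A , a∈A))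
      M₂ : Matching (λ x → R x ─ neighbours R A) (X ─ A)
      M₂ = go (X ─ A) (rec ∣X─A∣<∣X∣) (HallCondition-─-neighbours hallX A⊆X tight)
    ... | yes (x₀ , x₀∈X) | no noTight =
      glue ⁅ x₀ ⁆ ⁅ y₀ ⁆ M₁ (λ _ → x∈⁅x⁆ y₀) M₂
      where
      y₀ : Fin n
      y₀ = proj₁ (HallCondition⇒∃∈R hallX x₀∈X)
      M₁ : Matching R ⁅ x₀ ⁆
      M₁ = ⁅⁆-Matching (proj₂ (HallCondition⇒∃∈R hallX x₀∈X))
      surplus : ∀ {B} → B ⊆ X - x₀ → Nonempty B → ∣ B ∣ < ∣ neighbours R B ∣
      surplus {B} B⊆X-x₀ nonempty = ≰⇒> λ notSurplus →
        noTight (B , p─q⊆p X ⁅ x₀ ⁆ ∘ B⊆X-x₀ , nonempty ,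
                 ≤-<-trans (p⊆q⇒∣p∣≤∣q∣ B⊆X-x₀) (x∈p⇒∣p-x∣<∣p∣ x₀∈X) , notSurplus)
      M₂ : Matching (λ x → R x - y₀) (X - x₀)
      M₂ = go (X - x₀) (rec (x∈p⇒∣p-x∣<∣p∣ x₀∈X)) (surplus⇒HallCondition-y y₀ surplus)

  module Extension {R : Fin n → Subset n} {v : Fin n} (M : Matching (λ x → R x - v) (⊤ - v)) where

    match⁺ : Fin n → Fin n
    match⁺ x = if does (x ≟ᶠ v) then v else match M x

    match⁺-v : match⁺ v ≡ v
    match⁺-v rewrite dec-true (v ≟ᶠ v) refl = refl

    private
      M-∈ : ∀ {x} → x ≢ v → match M x ∈ R x - v
      M-∈ x≢v = match-∈ M (x∈p∧x≢y⇒x∈p-y ∈⊤ x≢v)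

      M-≢v : ∀ {x} → x ≢ v → match M x ≢ v
      M-≢v x≢v Mx≡v = x∈p─q⇒x∉q (M-∈ x≢v) (subst (_∈ ⁅ v ⁆) (sym Mx≡v) (x∈⁅x⁆ v))

    match⁺-∈ : ∀ {x} → x ≢ v → match⁺ x ∈ R x
    match⁺-∈ {x} x≢v with x ≟ᶠ v
    ... | yes x≡v = contradiction x≡v x≢v
    ... | no  _   = p─q⊆p _ ⁅ v ⁆ (M-∈ x≢v)

    match⁺-moved⇒≢v : ∀ {x} → match⁺ x ≢ x → x ≢ v
    match⁺-moved⇒≢v moved refl = moved match⁺-v

    match⁺-fixed⇒≡v : (∀ x → x ∉ R x) → ∀ {x} → match⁺ x ≡ x → x ≡ v
    match⁺-fixed⇒≡v x∉Rx {x} fixed with x ≟ᶠ v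
    ... | yes x≡v = x≡v
    ... | no  x≢v = contradiction (subst (_∈ R x) fixed (p─q⊆p _ ⁅ v ⁆ (M-∈ x≢v))) (x∉Rx x)

    match⁺-injective : Injective _≡_ _≡_ match⁺
    match⁺-injective {x} {x′} eq with x ≟ᶠ v | x′ ≟ᶠ v
    ... | yes x≡v | yes x′≡v = trans x≡v (sym x′≡v)
    ... | yes _   | no  x′≢v = contradiction (sym eq) (M-≢v x′≢v)
    ... | no  x≢v | yes _    = contradiction eq (M-≢v x≢v)
    ... | no  x≢v | no  x′≢v =
      match-injective M (x∈p∧x≢y⇒x∈p-y ∈⊤ x≢v) (x∈p∧x≢y⇒x∈p-y ∈⊤ x′≢v) eq

walk-preserves : ∀ {n} {E : EdgeFn n} (P : Fin n → Set) → (∀ {a b} → P a → 0 < E a b → P b) →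
                 ∀ {x y k} → Walk E x y k → P x → P y
walk-preserves P step []       px = px
walk-preserves P step (e ∷ w) px = walk-preserves P step w (step px e)

edge-sym : ∀ {n} (G : Graph n) {x y} → 0 < mult G x y → 0 < mult G y x
edge-sym G {x} {y} = subst (0 <_) (symm G x y)

module Expansion {n} (G : Graph n) where

  open Hall

  adjacent : Fin n → Subset n
  adjacent x = subset (λ y → 0 <? mult G x y)

  N : Subset n → Subset n
  N = neighbours adjacent

  ∈-adjacent⁺ : ∀ {x y} → 0 < mult G x y → y ∈ adjacent x
  ∈-adjacent⁺ {x} = ∈-subset⁺ (λ y → 0 <? mult G x y)

  ∈-adjacent⁻ : ∀ {x y} → y ∈ adjacent x → 0 < mult G x y
  ∈-adjacent⁻ {x} = ∈-subset⁻ (λ y → 0 <? mult G x y)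

  x∉adjacent[x] : ∀ x → x ∉ adjacent x
  x∉adjacent[x] x x∈ = contradiction (loopless G x) (>⇒≢ (∈-adjacent⁻ x∈))

  edge⇒∈N : ∀ {A x y} → x ∈ A → 0 < mult G x y → y ∈ N A
  edge⇒∈N x∈A e = ∈-neighbours⁺ x∈A (∈-adjacent⁺ e)

  module _ {r} (regular : RegularGraph G r) where

    ∑-mult-from : ∀ A → ∑[ x < n ] ∑[ y < n ] (𝟙 (x ∈? A) * mult G x y) ≡ r * ∣ A ∣
    ∑-mult-from A = begin
      ∑[ x < n ] ∑[ y < n ] (𝟙 (x ∈? A) * mult G x y)
        ≡⟨ sum-cong-≗ (λ x → *-distribˡ-sum (𝟙 (x ∈? A)) (mult G x)) ⟨
      ∑[ x < n ] (𝟙 (x ∈? A) * ∑[ y < n ] mult G x y)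
        ≡⟨ sum-cong-≗ (λ x → trans (cong (𝟙 (x ∈? A) *_) (degree x)) (*-comm _ r)) ⟩
      ∑[ x < n ] (r * 𝟙 (x ∈? A))
        ≡⟨ *-distribˡ-sum r (λ x → 𝟙 (x ∈? A)) ⟨
      r * ∑[ x < n ] 𝟙 (x ∈? A)
        ≡⟨ cong (r *_) (∣p∣≡∑𝟙 A) ⟨
      r * ∣ A ∣ ∎
      where
      open ≡-Reasoning
      degree : ∀ x → ∑[ y < n ] mult G x y ≡ r
      degree x = trans (sym (sum-tabulate (mult G x))) (regular x)

    ∑-mult-to : ∀ B → ∑[ x < n ] ∑[ y < n ] (𝟙 (y ∈? B) * mult G x y) ≡ r * ∣ B ∣
    ∑-mult-to B = begin
      ∑[ x < n ] ∑[ y < n ] (𝟙 (y ∈? B) * mult G x y)  ≡⟨ ∑-comm (λ x y → 𝟙 (y ∈? B) * mult G x y) ⟩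
      ∑[ y < n ] ∑[ x < n ] (𝟙 (y ∈? B) * mult G x y)
        ≡⟨ sum-cong-≗ (λ y → sum-cong-≗ (λ x → cong (𝟙 (y ∈? B) *_) (symm G x y))) ⟩
      ∑[ y < n ] ∑[ x < n ] (𝟙 (y ∈? B) * mult G y x)  ≡⟨ ∑-mult-from B ⟩
      r * ∣ B ∣                                      ∎
      where open ≡-Reasoning

    edges-from≤edges-to : ∀ A x y → 𝟙 (x ∈? A) * mult G x y ≤ 𝟙 (y ∈? N A) * mult G x y
    edges-from≤edges-to A x y with x ∈? A | y ∈? N A | 0 <? mult G x y
    ... | no _    | _       | _      = z≤n
    ... | yes _   | yes _   | _      = ≤-refl
    ... | yes x∈A | no y∉NA | yes e  = contradiction (edge⇒∈N x∈A e) y∉NA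
    ... | yes _   | no _    | no ¬e  = +-monoˡ-≤ 0 (≮⇒≥ ¬e)

    -- Both sides sum to r |A| resp. r |N A|, so |N A| ≤ |A| forces equality termwise.
    ∣N∣≤∣A∣⇒edges-from≡edges-to : ∀ {A} → ∣ N A ∣ ≤ ∣ A ∣ →
      ∀ x y → 𝟙 (x ∈? A) * mult G x y ≡ 𝟙 (y ∈? N A) * mult G x y
    ∣N∣≤∣A∣⇒edges-from≡edges-to {A} ∣NA∣≤∣A∣ x =
      ∑-mono-≤-≗ (edges-from≤edges-to A x) (≤-reflexive (sym (rows-equal x)))
      where
      ∑to≤∑from : ∑[ x < n ] ∑[ y < n ] (𝟙 (y ∈? N A) * mult G x y) ≤
                  ∑[ x < n ] ∑[ y < n ] (𝟙 (x ∈? A) * mult G x y)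
      ∑to≤∑from = subst₂ _≤_ (sym (∑-mult-to (N A))) (sym (∑-mult-from A)) (*-monoʳ-≤ r ∣NA∣≤∣A∣)
      rows-equal = ∑-mono-≤-≗ (λ x → ∑-mono-≤ (edges-from≤edges-to A x)) ∑to≤∑from

    ∣N∣≤∣A∣⇒closed : ∀ {A x y} → ∣ N A ∣ ≤ ∣ A ∣ → y ∈ N A → 0 < mult G x y → x ∈ A
    ∣N∣≤∣A∣⇒closed {A} {x} {y} ∣NA∣≤∣A∣ y∈NA e
      with x ∈? A | ∣N∣≤∣A∣⇒edges-from≡edges-to ∣NA∣≤∣A∣ x y
    ... | yes x∈A | _ = x∈A
    ... | no  _   | 0≡1*m rewrite dec-true (y ∈? N A) y∈NA =
      contradiction (trans 0≡1*m (+-identityʳ _)) (>⇒≢ e ∘ sym)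

    module _ (connected : Connected (mult G)) (nonBipartite : ¬ Bipartite G) where

      -- If |N A| ≤ |A| then A ∩ N A and A ∪ N A are closed under adjacency, so by connectivity
      -- the first is empty (it misses v) and the second is everything; hence no edge has both
      -- ends in A or both outside A.
      surplus : ∀ {A v} → v ∉ A → Nonempty A → ∣ A ∣ < ∣ N A ∣
      surplus {A} {v} v∉A (a , a∈A) = ≰⇒> λ tight → nonBipartite (colour , proper tight)
        where
        colour : Fin n → Bool
        colour x = does (x ∈? A)

        proper : ∣ N A ∣ ≤ ∣ A ∣ → ∀ x y → 0 < mult G x y → colour x ≢ colour y
        proper tight x y e same with x ∈? A | y ∈? A
        ... | yes x∈A | yes y∈A = v∉A (proj₁ (walk-preserves (λ z → z ∈ A × z ∈ N A) step
                                     (proj₂ (connected x v)) (x∈A , edge⇒∈N y∈A (edge-sym G e))))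
          where
          step : ∀ {b c} → b ∈ A × b ∈ N A → 0 < mult G b c → c ∈ A × c ∈ N A
          step (b∈A , b∈NA) e′ = ∣N∣≤∣A∣⇒closed tight b∈NA (edge-sym G e′) , edge⇒∈N b∈A e′
        ... | no  x∉A | no  y∉A with walk-preserves (λ z → z ∈ A ⊎ z ∈ N A) step
                                       (proj₂ (connected a x)) (inj₁ a∈A)
          where
          step : ∀ {b c} → b ∈ A ⊎ b ∈ N A → 0 < mult G b c → c ∈ A ⊎ c ∈ N A
          step (inj₁ b∈A)  e′ = inj₂ (edge⇒∈N b∈A e′)
          step (inj₂ b∈NA) e′ = inj₁ (∣N∣≤∣A∣⇒closed tight b∈NA (edge-sym G e′))
        ...   | inj₁ x∈A  = x∉A x∈A
        ...   | inj₂ x∈NA = y∉A (∣N∣≤∣A∣⇒closed tight x∈NA (edge-sym G e))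
        proper tight x y e () | yes _ | no _
        proper tight x y e () | no _  | yes _

      HallCondition-adjacent-v : ∀ v → HallCondition (λ x → adjacent x - v) (⊤ - v)
      HallCondition-adjacent-v v = surplus⇒HallCondition-y v λ A⊆⊤-v → surplus (v∉A A⊆⊤-v)
        where
        v∉A : ∀ {A} → A ⊆ ⊤ - v → v ∉ A
        v∉A A⊆⊤-v v∈A = x∈p─q⇒x∉q (A⊆⊤-v v∈A) (x∈⁅x⁆ v)

module CycleFactor {n} (G : Graph n) (σ : Fin n → Fin n) (σ-injective : Injective _≡_ _≡_ σ)
                   (σ-adjacent : ∀ x → σ x ≢ x → 0 < mult G x (σ x)) where

  fixedPoints : Fin n → Bool
  fixedPoints x = does (σ x ≟ᶠ x)

  Linked : Fin n → Fin n → Set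
  Linked x y = x ≢ y × (σ x ≡ y ⊎ σ y ≡ x)

  linked? : ∀ x y → Dec (Linked x y)
  linked? x y = ¬? (x ≟ᶠ y) ×-dec (σ x ≟ᶠ y ⊎-dec σ y ≟ᶠ x)

  cycleEdges : EdgeFn n
  cycleEdges x y = 𝟙 (linked? x y)

  σ⁻¹ : Fin n → Fin n
  σ⁻¹ y = proj₁ (injective⇒surjective σ-injective y)

  σσ⁻¹ : ∀ y → σ (σ⁻¹ y) ≡ y
  σσ⁻¹ y = proj₂ (injective⇒surjective σ-injective y)

  Linked-sym : ∀ {x y} → Linked x y → Linked y x
  Linked-sym (x≢y , σx≡y⊎σy≡x) = x≢y ∘ sym , swap σx≡y⊎σy≡x

  Linked⇒moved : ∀ {x y} → Linked x y → σ x ≢ x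
  Linked⇒moved (x≢y , inj₁ σx≡y) σx≡x = x≢y (trans (sym σx≡x) σx≡y)
  Linked⇒moved (x≢y , inj₂ σy≡x) σx≡x = x≢y (σ-injective (trans σx≡x (sym σy≡x)))

  module _ {x} (moved : σ x ≢ x) where

    σ⁻¹-moved : σ⁻¹ x ≢ x
    σ⁻¹-moved σ⁻¹x≡x = moved (trans (cong σ (sym σ⁻¹x≡x)) (σσ⁻¹ x))

    Linked⇒∈⁅σ⁆∪⁅σ⁻¹⁆ : ∀ {y} → Linked x y → y ∈ ⁅ σ x ⁆ ∪ ⁅ σ⁻¹ x ⁆
    Linked⇒∈⁅σ⁆∪⁅σ⁻¹⁆ (_ , inj₁ refl) = x∈p∪q⁺ (inj₁ (x∈⁅x⁆ (σ x)))
    Linked⇒∈⁅σ⁆∪⁅σ⁻¹⁆ (_ , inj₂ refl) =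
      x∈p∪q⁺ (inj₂ (subst (_∈ ⁅ σ⁻¹ (σ _) ⁆) (σ-injective (σσ⁻¹ (σ _))) (x∈⁅x⁆ _)))

    ∈⁅σ⁆∪⁅σ⁻¹⁆⇒Linked : ∀ {y} → y ∈ ⁅ σ x ⁆ ∪ ⁅ σ⁻¹ x ⁆ → Linked x y
    ∈⁅σ⁆∪⁅σ⁻¹⁆⇒Linked y∈ with x∈p∪q⁻ ⁅ σ x ⁆ ⁅ σ⁻¹ x ⁆ y∈
    ... | inj₁ y∈⁅σx⁆ with refl ← x∈⁅y⁆⇒x≡y _ y∈⁅σx⁆ = (λ x≡σx → moved (sym x≡σx)) , inj₁ refl
    ... | inj₂ y∈⁅σ⁻¹x⁆ with refl ← x∈⁅y⁆⇒x≡y _ y∈⁅σ⁻¹x⁆ =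
      (λ x≡σ⁻¹x → σ⁻¹-moved (sym x≡σ⁻¹x)) , inj₂ (σσ⁻¹ x)

    deg-moved : deg cycleEdges x ≡ ∣ ⁅ σ x ⁆ ∪ ⁅ σ⁻¹ x ⁆ ∣
    deg-moved = begin
      deg cycleEdges x                          ≡⟨ sum-tabulate (cycleEdges x) ⟩
      ∑[ y < n ] 𝟙 (linked? x y)                ≡⟨ sum-cong-≗ 𝟙-linked≗𝟙-∈ ⟩
      ∑[ y < n ] 𝟙 (y ∈? ⁅ σ x ⁆ ∪ ⁅ σ⁻¹ x ⁆)   ≡⟨ ∣p∣≡∑𝟙 (⁅ σ x ⁆ ∪ ⁅ σ⁻¹ x ⁆) ⟨
      ∣ ⁅ σ x ⁆ ∪ ⁅ σ⁻¹ x ⁆ ∣                   ∎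
      where
      open ≡-Reasoning
      𝟙-linked≗𝟙-∈ : ∀ y → 𝟙 (linked? x y) ≡ 𝟙 (y ∈? ⁅ σ x ⁆ ∪ ⁅ σ⁻¹ x ⁆)
      𝟙-linked≗𝟙-∈ y = 𝟙-cong Linked⇒∈⁅σ⁆∪⁅σ⁻¹⁆ ∈⁅σ⁆∪⁅σ⁻¹⁆⇒Linked (linked? x y) (y ∈? _)

    deg-2-cycle : σ (σ x) ≡ x → deg cycleEdges x ≡ 1
    deg-2-cycle σσx≡x =
      trans deg-moved (x≡y⇒∣⁅x⁆∪⁅y⁆∣≡1 (σ-injective (trans σσx≡x (sym (σσ⁻¹ x)))))

    deg-long-cycle : σ (σ x) ≢ x → deg cycleEdges x ≡ 2
    deg-long-cycle σσx≢x =
      trans deg-moved (x≢y⇒∣⁅x⁆∪⁅y⁆∣≡2 λ σx≡σ⁻¹x → σσx≢x (trans (cong σ σx≡σ⁻¹x) (σσ⁻¹ x)))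

    deg-moved-bounds : 1 ≤ deg cycleEdges x × deg cycleEdges x ≤ 2
    deg-moved-bounds with σ (σ x) ≟ᶠ x
    ... | yes σσx≡x rewrite deg-2-cycle σσx≡x    = ≤-refl , s≤s z≤n
    ... | no  σσx≢x rewrite deg-long-cycle σσx≢x = s≤s z≤n , ≤-refl

  deg-σ : ∀ {x} → σ x ≢ x → deg cycleEdges x ≡ deg cycleEdges (σ x)
  deg-σ {x} moved with σ (σ x) ≟ᶠ x
  ... | yes σσx≡x =
    trans (deg-2-cycle moved σσx≡x) (sym (deg-2-cycle (moved ∘ σ-injective) (cong σ σσx≡x)))
  ... | no  σσx≢x =
    trans (deg-long-cycle moved σσx≢x) (sym (deg-long-cycle (moved ∘ σ-injective) (σσx≢x ∘ σ-injective)))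

  edge-preserves-deg : ∀ {x y} → 0 < cycleEdges x y → deg cycleEdges x ≡ deg cycleEdges y
  edge-preserves-deg {x} {y} e with 0<𝟙⇒P (linked? x y) e
  ... | linked@(_ , inj₁ refl) = deg-σ (Linked⇒moved linked)
  ... | linked@(_ , inj₂ refl) = sym (deg-σ (Linked⇒moved (Linked-sym linked)))

  Linked⇒edge : ∀ {x y} → Linked x y → 0 < mult G x y
  Linked⇒edge {x}     linked@(_ , inj₁ refl) = σ-adjacent x (Linked⇒moved linked)
  Linked⇒edge {y = y} linked@(_ , inj₂ refl) = edge-sym G (σ-adjacent y (Linked⇒moved (Linked-sym linked)))

  σx≡x⇒fixed : ∀ {x} → σ x ≡ x → fixedPoints x ≡ true
  σx≡x⇒fixed {x} = dec-true (σ x ≟ᶠ x)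

  moved⇒not-fixed : ∀ {x} → σ x ≢ x → fixedPoints x ≡ false
  moved⇒not-fixed {x} = dec-false (σ x ≟ᶠ x)

  not-fixed⇒moved : ∀ {x} → fixedPoints x ≡ false → σ x ≢ x
  not-fixed⇒moved {x} not-fixed σx≡x = contradiction (trans (sym (dec-true (σ x ≟ᶠ x) σx≡x)) not-fixed) λ ()

  fixed⇒σx≡x : ∀ {x} → fixedPoints x ≡ true → σ x ≡ x
  fixed⇒σx≡x {x} fixed = decidable-stable (σ x ≟ᶠ x) λ moved →
    contradiction (trans (sym fixed) (moved⇒not-fixed moved)) λ ()

  cycleEdges-good : GoodFactorOfComplement G fixedPoints cycleEdges
  cycleEdges-good = cycleEdges≤mult , cycleEdges-sym , cycleEdges-avoids-fixed ,
                    (λ x → deg-moved-bounds ∘ not-fixed⇒moved) ,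
                    (λ x y k w → walk-preserves (λ z → deg cycleEdges x ≡ deg cycleEdges z)
                                   (λ eq e → trans eq (edge-preserves-deg e)) w refl)
    where
    cycleEdges≤mult : ∀ x y → cycleEdges x y ≤ mult G x y
    cycleEdges≤mult x y = 𝟙-≤ (linked? x y) Linked⇒edge

    cycleEdges-sym : ∀ x y → cycleEdges x y ≡ cycleEdges y x
    cycleEdges-sym x y = 𝟙-cong Linked-sym Linked-sym (linked? x y) (linked? y x)

    cycleEdges-avoids-fixed : ∀ x y → 0 < cycleEdges x y → fixedPoints x ≡ false × fixedPoints y ≡ false
    cycleEdges-avoids-fixed x y e = moved⇒not-fixed (Linked⇒moved linked) ,
                                    moved⇒not-fixed (Linked⇒moved (Linked-sym linked))
      where linked = 0<𝟙⇒P (linked? x y) e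

noEdges : ∀ {n} → EdgeFn n
noEdges _ _ = 0

noEdges-SubgraphOn : ∀ {n} (G : Graph n) S → SubgraphOn G S noEdges
noEdges-SubgraphOn G S = (λ _ _ → z≤n) , (λ _ _ → refl) , λ _ _ ()

deg-noEdges : ∀ {n} (x : Fin n) → deg noEdges x ≡ 0
deg-noEdges {n} x = trans (sum-tabulate (noEdges x)) (sum-replicate-zero n)

singleton-IsEvenTree : ∀ {n} (S : Fin n → Bool) {v} → S v ≡ true → (∀ {x} → S x ≡ true → x ≡ v) →
                       IsEvenTree S noEdges
singleton-IsEvenTree S {v} Sv only-v =
  ((v , Sv) , (λ _ _ → z≤n) , walk , λ { (_ , _ , _ , (() ∷ _) , _) }) ,
  λ x _ _ _ leaf _ → contradiction (trans (sym leaf) (deg-noEdges x)) λ ()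
  where
  walk : ∀ x y → S x ≡ true → S y ≡ true → ∃ λ k → Walk noEdges x y k
  walk x y Sx Sy rewrite only-v Sx | only-v Sy = 0 , []

theorem3 : (n : ℕ) (G : Graph n) (r : ℕ) → OddPos r → RegularGraph G r →
           Connected (mult G) → ¬ Bipartite G → HasGoodEvenTree G
theorem3 zero    G r _ regular connected nonBipartite = contradiction ((λ ()) , λ ()) nonBipartite
theorem3 (suc n) G r _ regular connected nonBipartite =
  fixedPoints , noEdges , noEdges-SubgraphOn G fixedPoints ,
  singleton-IsEvenTree fixedPoints (σx≡x⇒fixed match⁺-v) (match⁺-fixed⇒≡v x∉adjacent[x] ∘ fixed⇒σx≡x) ,
  cycleEdges , cycleEdges-good
  where
  open Hall
  open Expansion G
  v : Fin (suc n)
  v = zero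
  M : Matching (λ x → adjacent x - v) (⊤ - v)
  M = hall (⊤ - v) (HallCondition-adjacent-v regular connected nonBipartite v)
  open Extension {R = adjacent} {v = v} M
  σ-adjacent : ∀ x → match⁺ x ≢ x → 0 < mult G x (match⁺ x)
  σ-adjacent x moved = ∈-adjacent⁻ (match⁺-∈ (match⁺-moved⇒≢v moved))
  open CycleFactor G match⁺ match⁺-injective σ-adjacent
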